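{- For all positive integers $k,n$, it holds that $$s_{k,n} = a_{k,(n-1)k}.$$
   Context: A finite nonempty set $F\subset\mathbb{N}$ is called Schreier if $\min F\ge |F|$. For $k,n\in\mathbb{N}$, let $s_{k,n}$ be the number of sets $F\subset\{k,2k,\ldots,nk\}$ such that $F$ is Schreier and $nk\in F$. For $k\ge 1$, define the sequence $(a_{k,n})_{n=0}^\infty$ by $a_{k,0}=a_{k,1}=1$, $a_{k,2}=\cdots=a_{k,k}=2$, and $a_{k,n}=a_{k,n-k}+a_{k,n-k-1}$ for $n\ge k+1$. -}

module Defs where

open import Data.Nat using (ℕ; zero; suc; _+_; _*_; _∸_; _≤ᵇ_; _≡ᵇ_; _⊓_)
open import Data.Bool using (Bool; true; false; if_then_else_; _∧_)
open import Data.List using (List; []; _∷_; _++_; map; filterᵇ; length; foldr)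
open import Data.Bool.ListAction using (any)
open import Data.Vec using (Vec; []; _∷_)
open import Data.Fin.Subset using (Subset; inside; outside)

subsets : (n : ℕ) → List (Subset n)
subsets zero = [] ∷ []
subsets (suc n) = map (inside ∷_) (subsets n) ++ map (outside ∷_) (subsets n)

-- the subset of {k,2k,…,nk} encoded by p : index i (0-based) ↦ (i+1)k
elemsFrom : ℕ → ℕ → {n : ℕ} → Subset n → List ℕ
elemsFrom k j [] = []
elemsFrom k j (true ∷ p) = (j * k) ∷ elemsFrom k (suc j) p
elemsFrom k j (false ∷ p) = elemsFrom k (suc j) p

setOf : (k : ℕ) → {n : ℕ} → Subset n → List ℕ
setOf k p = elemsFrom k 1 p

-- minimum of a nonempty list (value irrelevant for [])
minList : List ℕ → ℕ
minList [] = 0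
minList (x ∷ xs) = foldr _⊓_ x xs

isSchreier : List ℕ → Bool
isSchreier [] = false
isSchreier F@(_ ∷ _) = length F ≤ᵇ minList F

memᵇ : ℕ → List ℕ → Bool
memᵇ x xs = any (x ≡ᵇ_) xs

s : ℕ → ℕ → ℕ
s k n = length (filterᵇ (λ p → isSchreier (setOf k p) ∧ memᵇ (n * k) (setOf k p)) (subsets n))

aFuel : ℕ → ℕ → ℕ → ℕ
aFuel zero k n = 0
aFuel (suc f) k n =
  if n ≤ᵇ 1 then 1
  else if n ≤ᵇ k then 2
  else aFuel f k (n ∸ k) + aFuel f k (n ∸ k ∸ 1)

-- fuel n+1 suffices when k ≥ 1 (each step decreases n by at least k ≥ 1)
a : ℕ → ℕ → ℕ
a k n = aFuel (suc n) k n

-- Index the candidates k, 2k, …, nk by their positions and relax the Schreier condition to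
-- c + |F| ≤ min F. Count such sets on the positions j, …, j+n that contain the top position and
-- split on whether the next-to-top position is used: if not, the top element moves down by one
-- position; if so, it can be dropped at the price of one more unit of c. Read against the index
-- (j + n)k − c, this Pascal-type rule is the recursion a_{i+k} = a_i + a_{i−1}, and for n = 0 the
-- count (1 if c < jk, else 0) matches a continued to the indices −k, …, 0.
module Submission where

open import Defs
open import Data.Bool using (Bool; true; false; T; if_then_else_; _∧_)
open import Data.Bool.Properties using (T-≡; ¬-not; ∧-comm)
open import Data.Fin.Subset using (Subset; inside; outside; ∣_∣)
open import Data.List using (List; []; _∷_; _++_; map; filterᵇ; length; foldr)
open import Data.List.Properties using (filter-++; length-++; filter-≐)
open import Data.Nat
open import Data.Nat.Properties
open import Algebra.Properties.CommutativeSemigroup +-commutativeSemigroup using (interchange)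
open import Data.Product using (_,_)
open import Data.Sum using (inj₁; inj₂)
open import Data.Vec using ([]; _∷_; last)
open import Function using (_∘_; Equivalence)
open import Relation.Binary.PropositionalEquality
open import Relation.Nullary using (yes; no; T?)
open ≡-Reasoning

≤⇒≤ᵇ≡true : ∀ {m n} → m ≤ n → (m ≤ᵇ n) ≡ true
≤⇒≤ᵇ≡true = Equivalence.to T-≡ ∘ ≤⇒≤ᵇ

>⇒≤ᵇ≡false : ∀ {m n} → n < m → (m ≤ᵇ n) ≡ false
>⇒≤ᵇ≡false n<m = ¬-not (<⇒≱ n<m ∘ ≤ᵇ⇒≤ _ _ ∘ Equivalence.from T-≡)

≢⇒≡ᵇ≡false : ∀ {m n} → m ≢ n → (m ≡ᵇ n) ≡ false
≢⇒≡ᵇ≡false m≢n = ¬-not (m≢n ∘ ≡ᵇ⇒≡ _ _ ∘ Equivalence.from T-≡)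

≡ᵇ-refl : ∀ m → (m ≡ᵇ m) ≡ true
≡ᵇ-refl m = Equivalence.to T-≡ (≡⇒≡ᵇ m m refl)

count : {A : Set} → (A → Bool) → List A → ℕ
count P xs = length (filterᵇ P xs)

count-++ : {A : Set} (P : A → Bool) (xs ys : List A) → count P (xs ++ ys) ≡ count P xs + count P ys
count-++ P xs ys = trans (cong length (filter-++ (T? ∘ P) xs ys)) (length-++ (filterᵇ P xs))

count-map : {A B : Set} (P : B → Bool) (f : A → B) (xs : List A) →
  count P (map f xs) ≡ count (P ∘ f) xs
count-map P f [] = refl
count-map P f (x ∷ xs) with P (f x)
... | true  = cong suc (count-map P f xs)
... | false = count-map P f xs

count-cong : {A : Set} {P Q : A → Bool} → (∀ x → P x ≡ Q x) → (xs : List A) →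
  count P xs ≡ count Q xs
count-cong {P = P} {Q} P≗Q xs =
  cong length (filter-≐ (T? ∘ P) (T? ∘ Q) ((λ {x} → subst T (P≗Q x)) , (λ {x} → subst T (sym (P≗Q x)))) xs)

count-subsets-suc : ∀ n (P : Subset (suc n) → Bool) →
  count P (subsets (suc n)) ≡ count (P ∘ (inside ∷_)) (subsets n) + count (P ∘ (outside ∷_)) (subsets n)
count-subsets-suc n P = begin
  count P (map (inside ∷_) (subsets n) ++ map (outside ∷_) (subsets n))
    ≡⟨ count-++ P (map (inside ∷_) (subsets n)) _ ⟩
  count P (map (inside ∷_) (subsets n)) + count P (map (outside ∷_) (subsets n))
    ≡⟨ cong₂ _+_ (count-map P (inside ∷_) (subsets n)) (count-map P (outside ∷_) (subsets n)) ⟩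
  count (P ∘ (inside ∷_)) (subsets n) + count (P ∘ (outside ∷_)) (subsets n) ∎

-- With positions starting at j, p encodes F = {(j + i)k : p i = inside}, and endingSchreier k c j p
-- says that F contains the top position and c + |F| ≤ min F. Above its minimum jk, F is an
-- admissibleTail with t = c + 1 and u = jk; b records whether the position before p is in F.
admissibleTail : ∀ {n} → Bool → ℕ → ℕ → Subset n → Bool
admissibleTail b t u p = last (b ∷ p) ∧ (t + ∣ p ∣ ≤ᵇ u)

endingSchreier : ℕ → ℕ → ℕ → ∀ {n} → Subset n → Bool
endingSchreier k c j []          = false
endingSchreier k c j (true ∷ p)  = admissibleTail true (suc c) (j * k) p
endingSchreier k c j (false ∷ p) = endingSchreier k c (suc j) p

#admissibleTails : Bool → ℕ → ℕ → ℕ → ℕ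
#admissibleTails b t u zero    = if b ∧ (t ≤ᵇ u) then 1 else 0
#admissibleTails b t u (suc n) = #admissibleTails true (suc t) u n + #admissibleTails false t u n

#endingSchreier : ℕ → ℕ → ℕ → ℕ → ℕ
#endingSchreier k c j zero    = 0
#endingSchreier k c j (suc n) = #admissibleTails true (suc c) (j * k) n + #endingSchreier k c (suc j) n

count-admissibleTail : ∀ b t u n → count (admissibleTail b t u) (subsets n) ≡ #admissibleTails b t u n
count-admissibleTail b t u zero rewrite +-identityʳ t with b ∧ (t ≤ᵇ u)
... | true  = refl
... | false = refl
count-admissibleTail b t u (suc n) = begin
  count (admissibleTail b t u) (subsets (suc n))
    ≡⟨ count-subsets-suc n (admissibleTail b t u) ⟩
  count (admissibleTail b t u ∘ (inside ∷_)) (subsets n) + count (admissibleTail false t u) (subsets n)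
    ≡⟨ cong (_+ count (admissibleTail false t u) (subsets n)) (count-cong shift (subsets n)) ⟩
  count (admissibleTail true (suc t) u) (subsets n) + count (admissibleTail false t u) (subsets n)
    ≡⟨ cong₂ _+_ (count-admissibleTail true (suc t) u n) (count-admissibleTail false t u n) ⟩
  #admissibleTails b t u (suc n) ∎
  where
  shift : ∀ p → admissibleTail b t u (inside ∷ p) ≡ admissibleTail true (suc t) u p
  shift p = cong (λ v → last (true ∷ p) ∧ (v ≤ᵇ u)) (+-suc t ∣ p ∣)

count-endingSchreier : ∀ k c j n → count (endingSchreier k c j) (subsets n) ≡ #endingSchreier k c j n
count-endingSchreier k c j zero    = refl
count-endingSchreier k c j (suc n) =
  trans (count-subsets-suc n (endingSchreier k c j))
        (cong₂ _+_ (count-admissibleTail true (suc c) (j * k) n) (count-endingSchreier k c (suc j) n))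

#admissibleTails-overfull : ∀ {b t u} n → u < t → #admissibleTails b t u n ≡ 0
#admissibleTails-overfull {true}  zero    u<t rewrite >⇒≤ᵇ≡false u<t = refl
#admissibleTails-overfull {false} zero    u<t = refl
#admissibleTails-overfull         (suc n) u<t =
  cong₂ _+_ (#admissibleTails-overfull n (m<n⇒m<1+n u<t)) (#admissibleTails-overfull n u<t)

#endingSchreier-pascal : ∀ k n {c j} → suc c ≤ (j + n) * k →
  #endingSchreier k c j (2 + n) ≡ #endingSchreier k c j (1 + n) + #endingSchreier k (suc c) j (1 + n)
#endingSchreier-pascal k zero {c} {j} 1+c≤jk rewrite +-identityʳ j
  | ≤⇒≤ᵇ≡true 1+c≤jk | ≤⇒≤ᵇ≡true (≤-trans 1+c≤jk (m≤n+m (j * k) k)) = +-comm _ 1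
-- #admissibleTails b t u (suc n) does not depend on b, so the first summand on the left splits as B + A.
#endingSchreier-pascal k (suc n) {c} {j} 1+c≤X = begin
  (B + A) + #endingSchreier k c (suc j) (2 + n)
    ≡⟨ cong ((B + A) +_) (#endingSchreier-pascal k n (subst (λ i → suc c ≤ i * k) (+-suc j n) 1+c≤X)) ⟩
  (B + A) + (C + D)   ≡⟨ cong (_+ (C + D)) (+-comm B A) ⟩
  (A + B) + (C + D)   ≡⟨ interchange A B C D ⟩
  (A + C) + (B + D)   ∎
  where
  A = #admissibleTails true (suc c) (j * k) (1 + n)
  B = #admissibleTails true (2 + c) (j * k) (1 + n)
  C = #endingSchreier k c (suc j) (1 + n)
  D = #endingSchreier k (suc c) (suc j) (1 + n)

length-elemsFrom : ∀ k j {n} (p : Subset n) → length (elemsFrom k j p) ≡ ∣ p ∣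
length-elemsFrom k j []          = refl
length-elemsFrom k j (true ∷ p)  = cong suc (length-elemsFrom k (suc j) p)
length-elemsFrom k j (false ∷ p) = length-elemsFrom k (suc j) p

foldr-⊓-elemsFrom : ∀ k j {x n} (p : Subset n) → x ≤ j * k → foldr _⊓_ x (elemsFrom k j p) ≡ x
foldr-⊓-elemsFrom k j []          x≤jk = refl
foldr-⊓-elemsFrom k j {x} (true ∷ p) x≤jk = begin
  j * k ⊓ foldr _⊓_ x (elemsFrom k (suc j) p) ≡⟨ cong (j * k ⊓_) (foldr-⊓-elemsFrom k (suc j) p x≤[1+j]k) ⟩
  j * k ⊓ x                                   ≡⟨ m≥n⇒m⊓n≡n x≤jk ⟩
  x                                           ∎
  where
  x≤[1+j]k : x ≤ suc j * k
  x≤[1+j]k = ≤-trans x≤jk (m≤n+m (j * k) k)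
foldr-⊓-elemsFrom k j (false ∷ p) x≤jk = foldr-⊓-elemsFrom k (suc j) p (≤-trans x≤jk (m≤n+m (j * k) k))

module _ (k : ℕ) .{{_ : NonZero k}} where

  memᵇ-elemsFrom : ∀ j {m} b (p : Subset m) → memᵇ ((j + m) * k) (elemsFrom k j (b ∷ p)) ≡ last (b ∷ p)
  memᵇ-elemsFrom j true  [] rewrite +-identityʳ j | ≡ᵇ-refl (j * k) = refl
  memᵇ-elemsFrom j false [] = refl
  memᵇ-elemsFrom j {suc m} true (x ∷ p)
    rewrite ≢⇒≡ᵇ≡false (>⇒≢ (*-monoˡ-< k (m<m+n j {suc m} z<s))) | +-suc j m = memᵇ-elemsFrom (suc j) x p
  memᵇ-elemsFrom j {suc m} false (x ∷ p) rewrite +-suc j m = memᵇ-elemsFrom (suc j) x p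

  endingSchreier-elemsFrom : ∀ j {m} (p : Subset (suc m)) →
    (isSchreier (elemsFrom k j p) ∧ memᵇ ((j + m) * k) (elemsFrom k j p)) ≡ endingSchreier k 0 j p
  endingSchreier-elemsFrom j (true ∷ p)
    rewrite length-elemsFrom k (suc j) p | foldr-⊓-elemsFrom k (suc j) p (m≤n+m (j * k) k)
          | memᵇ-elemsFrom j true p = ∧-comm (suc ∣ p ∣ ≤ᵇ j * k) (last (true ∷ p))
  endingSchreier-elemsFrom j {zero} (false ∷ []) = refl
  endingSchreier-elemsFrom j {suc m} (false ∷ p) rewrite +-suc j m = endingSchreier-elemsFrom (suc j) p

  s≡#endingSchreier : ∀ m → s k (suc m) ≡ #endingSchreier k 0 1 (suc m)
  s≡#endingSchreier m =
    trans (count-cong (endingSchreier-elemsFrom 1) (subsets (suc m))) (count-endingSchreier k 0 1 (suc m))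

-- aExt k i = a_{k,i−k}, continued below index 0 by a_{k,−k} = 0 and a_{k,−i} = 1 (0 < i < k):
-- the values with which a_{k,i} = a_{k,i−k} + a_{k,i−k−1} holds for every i ≥ 1.
aExt : ℕ → ℕ → ℕ
aExt k zero    = 0
aExt k (suc i) = if suc i ≤ᵇ k then 1 else a k (suc i ∸ k)

module _ (k : ℕ) .{{_ : NonZero k}} where

  aFuel-irrelevant : ∀ {f g m} → m < f → m < g → aFuel f k m ≡ aFuel g k m
  aFuel-irrelevant {suc f} {suc g} {zero}  _   _   = refl
  aFuel-irrelevant {suc f} {suc g} {suc m} m<f m<g with suc m ≤ᵇ 1 | suc m ≤ᵇ k
  ... | true  | _     = refl
  ... | false | true  = refl
  ... | false | false = cong₂ _+_ (aFuel-irrelevant (below m<f) (below m<g))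
                                  (aFuel-irrelevant (≤-<-trans (m∸n≤m _ 1) (below m<f))
                                                    (≤-<-trans (m∸n≤m _ 1) (below m<g)))
    where
    below : ∀ {h} → suc m < suc h → suc m ∸ k < h
    below m<h = ≤-<-trans (∸-monoʳ-≤ (suc m) (>-nonZero⁻¹ k)) (s≤s⁻¹ m<h)

  aFuel-sufficient : ∀ {f m} → m < f → aFuel f k m ≡ a k m
  aFuel-sufficient m<f = aFuel-irrelevant m<f ≤-refl

  aFuel-unfold : ∀ f m → (m ≤ᵇ 1) ≡ false → (m ≤ᵇ k) ≡ false →
    aFuel (suc f) k m ≡ aFuel f k (m ∸ k) + aFuel f k (m ∸ k ∸ 1)
  aFuel-unfold f m m≰1 m≰k rewrite m≰1 | m≰k = refl

  a-two : ∀ m → 2 + m ≤ k → a k (2 + m) ≡ 2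
  a-two m 2+m≤k rewrite ≤⇒≤ᵇ≡true 2+m≤k = refl

  a-rec : ∀ r → a k (k + suc r) ≡ a k (suc r) + a k r
  a-rec r = begin
    a k (k + suc r)
      ≡⟨ aFuel-unfold (k + suc r) (k + suc r) (>⇒≤ᵇ≡false 1<k+1+r) (>⇒≤ᵇ≡false (m<m+n k z<s)) ⟩
    aFuel (k + suc r) k (k + suc r ∸ k) + aFuel (k + suc r) k (k + suc r ∸ k ∸ 1)
      ≡⟨ cong (λ i → aFuel (k + suc r) k i + aFuel (k + suc r) k (i ∸ 1)) (m+n∸m≡n k (suc r)) ⟩
    aFuel (k + suc r) k (suc r) + aFuel (k + suc r) k r
      ≡⟨ cong₂ _+_ (aFuel-sufficient 1+r<k+1+r) (aFuel-sufficient (<-trans (n<1+n r) 1+r<k+1+r)) ⟩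
    a k (suc r) + a k r ∎
    where
    1<k+1+r : 1 < k + suc r
    1<k+1+r = +-mono-≤ (>-nonZero⁻¹ k) (s≤s z≤n)
    1+r<k+1+r : suc r < k + suc r
    1+r<k+1+r = m<n+m (suc r) (>-nonZero⁻¹ k)

  aExt-≤ : ∀ {i} → 0 < i → i ≤ k → aExt k i ≡ 1
  aExt-≤ {suc i} _ i≤k rewrite ≤⇒≤ᵇ≡true i≤k = refl

  aExt-+ : ∀ x → aExt k (k + x) ≡ a k x
  aExt-+ zero rewrite +-identityʳ k = aExt-≤ (>-nonZero⁻¹ k) ≤-refl
  aExt-+ (suc x) rewrite +-suc k x | >⇒≤ᵇ≡false (s≤s (m≤m+n k x)) =
    cong (a k) (trans (cong (_∸ k) (sym (+-suc k x))) (m+n∸m≡n k (suc x)))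

  aExt-rec : ∀ y → aExt k (k + suc y) ≡ aExt k (suc y) + aExt k y
  aExt-rec y with suc y ≤? k
  aExt-rec zero    | yes 1≤k = trans (aExt-+ 1) (sym (cong (_+ 0) (aExt-≤ z<s 1≤k)))
  aExt-rec (suc z) | yes 2+z≤k = begin
    aExt k (k + suc (suc z))            ≡⟨ aExt-+ (suc (suc z)) ⟩
    a k (suc (suc z))                   ≡⟨ a-two z 2+z≤k ⟩
    1 + 1                               ≡⟨ cong₂ _+_ (aExt-≤ z<s 2+z≤k) (aExt-≤ z<s (≤-trans (n≤1+n _) 2+z≤k)) ⟨
    aExt k (suc (suc z)) + aExt k (suc z) ∎
  aExt-rec y | no 1+y≰k with m≤n⇒∃[o]m+o≡n (s≤s⁻¹ (≰⇒> 1+y≰k))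
  ... | w , refl = begin
    aExt k (k + suc (k + w))               ≡⟨ aExt-+ (suc (k + w)) ⟩
    a k (suc (k + w))                      ≡⟨ cong (a k) (+-suc k w) ⟨
    a k (k + suc w)                        ≡⟨ a-rec w ⟩
    a k (suc w) + a k w                    ≡⟨ cong₂ _+_ (aExt-+ (suc w)) (aExt-+ w) ⟨
    aExt k (k + suc w) + aExt k (k + w)    ≡⟨ cong (λ i → aExt k i + aExt k (k + w)) (+-suc k w) ⟩
    aExt k (suc (k + w)) + aExt k (k + w)  ∎

  #endingSchreier≡aExt : ∀ n {c j} → c ≤ j * k → j * k ≤ c + k →
    #endingSchreier k c j (suc n) ≡ aExt k ((j + n) * k ∸ c)
  #endingSchreier≡aExt zero {c} {j} c≤jk jk≤c+k rewrite +-identityʳ j with m≤n⇒m<n∨m≡n c≤jk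
  ... | inj₁ c<jk rewrite ≤⇒≤ᵇ≡true c<jk =
    sym (aExt-≤ (m<n⇒0<n∸m c<jk) (m≤n+o⇒m∸n≤o (j * k) c jk≤c+k))
  ... | inj₂ refl rewrite >⇒≤ᵇ≡false (n<1+n (j * k)) | n∸n≡0 (j * k) = refl
  #endingSchreier≡aExt (suc n) {c} {j} c≤jk jk≤c+k with m≤n⇒m<n∨m≡n c≤jk
  ... | inj₁ c<jk = begin
    #endingSchreier k c j (2 + n)
      ≡⟨ #endingSchreier-pascal k n (≤-trans c<jk jk≤X) ⟩
    #endingSchreier k c j (1 + n) + #endingSchreier k (suc c) j (1 + n)
      ≡⟨ cong₂ _+_ (#endingSchreier≡aExt n c≤jk jk≤c+k) (#endingSchreier≡aExt n c<jk (m≤n⇒m≤1+n jk≤c+k)) ⟩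
    aExt k (X ∸ c) + aExt k (X ∸ suc c)
      ≡⟨ cong (λ i → aExt k i + aExt k (X ∸ suc c)) X∸c≡1+X∸1+c ⟩
    aExt k (suc (X ∸ suc c)) + aExt k (X ∸ suc c)
      ≡⟨ aExt-rec (X ∸ suc c) ⟨
    aExt k (k + suc (X ∸ suc c))
      ≡⟨ cong (λ i → aExt k (k + i)) X∸c≡1+X∸1+c ⟨
    aExt k (k + (X ∸ c))
      ≡⟨ cong (aExt k) (+-∸-assoc k (≤-trans c≤jk jk≤X)) ⟨
    aExt k (suc (j + n) * k ∸ c)
      ≡⟨ cong (λ i → aExt k (i * k ∸ c)) (+-suc j n) ⟨
    aExt k ((j + suc n) * k ∸ c) ∎
    where
    X = (j + n) * k
    jk≤X : j * k ≤ X
    jk≤X = *-monoˡ-≤ k (m≤m+n j n)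
    X∸c≡1+X∸1+c : X ∸ c ≡ suc (X ∸ suc c)
    X∸c≡1+X∸1+c = +-∸-assoc 1 (≤-trans c<jk jk≤X)
  ... | inj₂ refl = begin
    #admissibleTails true (suc (j * k)) (j * k) (1 + n) + #endingSchreier k (j * k) (suc j) (1 + n)
      ≡⟨ cong (_+ #endingSchreier k (j * k) (suc j) (1 + n))
              (#admissibleTails-overfull {true} (1 + n) (n<1+n (j * k))) ⟩
    #endingSchreier k (j * k) (suc j) (1 + n)
      ≡⟨ #endingSchreier≡aExt n (m≤n+m (j * k) k) (≤-reflexive (+-comm k (j * k))) ⟩
    aExt k ((suc j + n) * k ∸ j * k)
      ≡⟨ cong (λ i → aExt k (i * k ∸ j * k)) (+-suc j n) ⟨
    aExt k ((j + suc n) * k ∸ j * k) ∎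

theorem1p1 : (k n : ℕ) → k ≥ 1 → n ≥ 1 → s k n ≡ a k ((n ∸ 1) * k)
theorem1p1 k@(suc _) (suc m) _ _ = begin
  s k (suc m)                   ≡⟨ s≡#endingSchreier k m ⟩
  #endingSchreier k 0 1 (suc m) ≡⟨ #endingSchreier≡aExt k m z≤n (≤-reflexive (+-identityʳ k)) ⟩
  aExt k (k + m * k)            ≡⟨ aExt-+ k (m * k) ⟩
  a k (m * k)                   ∎
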